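{- If $x$ is a precisely almost periodic sequence and $y$ is a periodic sequence (over finite alphabets), then $x\times y$ is precisely almost periodic.
   Context: Sequences over a finite alphabet $A$ are maps $\mathbb{N}\to A$; $x[i,j]=x(i)\dots x(j)$. $y$ is periodic if there is $T\geqslant1$ with $y(i)=y(i+T)$ for all $i$. $x$ is precisely almost periodic if for every finite word $u$ occurring in $x$ there exist $a\in\mathbb{N}$ and $d\geqslant1$ such that $x[a+id,\,a+id+|u|-1]=u$ for all $i\geqslant0$. For $x\in A^{\mathbb{N}}$, $y\in B^{\mathbb{N}}$ the product $x\times y\in(A\times B)^{\mathbb{N}}$ is $(x\times y)(i)=\langle x(i),y(i)\rangle$. -}

module Defs where

open import Data.Nat using (ℕ; _+_; _*_; _≥_)
open import Data.Fin using (Fin; toℕ)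
open import Data.Vec using (Vec; lookup)
open import Data.Product using (Σ; _×_; _,_; ∃)
open import Relation.Binary.PropositionalEquality using (_≡_)

Seq : Set → Set
Seq A = ℕ → A

OccursAt : {A : Set} {m : ℕ} → Seq A → ℕ → Vec A m → Set
OccursAt x p u = ∀ j → x (p + toℕ j) ≡ lookup u j

Occurs : {A : Set} {m : ℕ} → Seq A → Vec A m → Set
Occurs x u = ∃ λ p → OccursAt x p u

Periodic : {A : Set} → Seq A → Set
Periodic y = Σ ℕ λ T → T ≥ 1 × (∀ i → y i ≡ y (i + T))

PreciselyAlmostPeriodic : {A : Set} → Seq A → Set
PreciselyAlmostPeriodic x =
  ∀ {m} (u : Vec _ m) → Occurs x u →
    Σ ℕ λ a → Σ ℕ λ d → d ≥ 1 × (∀ i → OccursAt x (a + i * d) u)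

_⊗_ : {A B : Set} → Seq A → Seq B → Seq (A × B)
(x ⊗ y) i = x i , y i

module Submission where

-- Write P_L for the prefix x[0, L-1].  Precise almost
-- periodicity applied to P_L gives an arithmetic progression a + j·d of
-- positions at which P_L reappears.  If we can choose such a progression with
-- the period T of y dividing both a and d, then at every position a + j·d the
-- sequence y also looks like its beginning, so P_L reappears in x ⊗ y along the
-- same progression; taking L beyond a given occurrence of a word w then makes w
-- recur along a progression too.
--
-- Making T divide d is free (pass to the sub-progression j ↦ j·T).  To get T ∣ a
-- we build a chain of lengths L₀ = L, L_{k+1} = b_k + L_k, where P_{L_k} recurs
-- along a progression starting at b_k.  Since P_{L_k} occurs at position b_k of
-- P_{L_{k+1}}, progressions compose down the chain, so P_{L_i} recurs along a
-- progression starting at the block sum b_i + … + b_{i+n}, and so does the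
-- shorter prefix P_L.  By the pigeonhole principle two of the partial sums
-- b_0 + … + b_{k-1} (k = 0, …, T) agree mod T, which yields a block sum
-- divisible by T.

open import Defs
open import Data.Nat using (ℕ; zero; suc; _+_; _*_; _∸_; _≤_; _<_; _≥_; NonZero; >-nonZero⁻¹)
open import Data.Nat.Properties
open import Data.Nat.DivMod using (_mod_; _divMod_; DivMod)
open import Data.Nat.Divisibility using (_∣_; divides; n∣m*n; m∣m*n; ∣n⇒∣m*n; ∣m∣n⇒∣m+n; ∣m+n∣m⇒∣n)
open import Algebra.Properties.CommutativeSemigroup +-commutativeSemigroup using (xy∙z≈xz∙y; xy∙z≈yz∙x)
open import Data.Fin using (Fin; toℕ; fromℕ<)
open import Data.Fin.Properties using (toℕ-fromℕ<; toℕ<n; pigeonhole)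
open import Data.Vec using (Vec; lookup; tabulate)
open import Data.Vec.Properties using (lookup∘tabulate)
open import Data.Product using (Σ; _×_; _,_; proj₁)
open import Relation.Binary.PropositionalEquality

PrefixAt : {A : Set} → Seq A → ℕ → ℕ → Set
PrefixAt x L q = ∀ t → t < L → x (q + t) ≡ x t

PrefixProgression : {A : Set} → Seq A → ℕ → ℕ → ℕ → Set
PrefixProgression x L a d = ∀ j → PrefixAt x L (a + j * d)

PrefixRecurrence : {A : Set} → Seq A → ℕ → Set
PrefixRecurrence x L = Σ ℕ λ a → Σ ℕ λ d → d ≥ 1 × PrefixProgression x L a d

module _ {A : Set} {x : Seq A} where

  prefixAt-compose : ∀ {L' L q c} → PrefixAt x L' q → PrefixAt x L c → c + L ≤ L' →
                     PrefixAt x L (q + c)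
  prefixAt-compose {q = q} {c} outer inner c+L≤L' t t<L = begin
    x (q + c + t)  ≡⟨ cong x (+-assoc q c t) ⟩
    x (q + (c + t)) ≡⟨ outer (c + t) (≤-trans (+-monoʳ-< c t<L) c+L≤L') ⟩
    x (c + t)      ≡⟨ inner t t<L ⟩
    x t            ∎
    where open ≡-Reasoning

  occursAt-transfer : ∀ {m p q} {w : Vec A m} → PrefixAt x (p + m) q →
                      OccursAt x p w → OccursAt x (q + p) w
  occursAt-transfer {p = p} {q} recurs occ t =
    trans (cong x (+-assoc q p (toℕ t)))
          (trans (recurs (p + toℕ t) (+-monoʳ-< p (toℕ<n t))) (occ t))

  progression-shift : ∀ {L' L a d c} → PrefixProgression x L' a d → PrefixAt x L c →
                      c + L ≤ L' → PrefixProgression x L (a + c) d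
  progression-shift {a = a} {d} {c} prog inner c+L≤L' j =
    subst (PrefixAt x _) (xy∙z≈xz∙y a (j * d) c) (prefixAt-compose (prog j) inner c+L≤L')

  progression-restrict : ∀ {L' L a d} → L ≤ L' → PrefixProgression x L' a d →
                         PrefixProgression x L a d
  progression-restrict L≤L' prog j t t<L = prog j t (≤-trans t<L L≤L')

  progression-multiple : ∀ {L a d} k → PrefixProgression x L a d →
                         PrefixProgression x L a (k * d)
  progression-multiple {L} {a} {d} k prog j =
    subst (λ e → PrefixAt x L (a + e)) (*-assoc j k d) (prog (j * k))

  prefix : (L : ℕ) → Vec A L
  prefix L = tabulate (λ f → x (toℕ f))

  occursAt-prefix : ∀ {L q} → OccursAt x q (prefix L) → PrefixAt x L q
  occursAt-prefix {L} {q} occ t t<L = begin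
    x (q + t)                        ≡⟨ cong (λ s → x (q + s)) (sym (toℕ-fromℕ< t<L)) ⟩
    x (q + toℕ (fromℕ< t<L))         ≡⟨ occ (fromℕ< t<L) ⟩
    lookup (prefix L) (fromℕ< t<L)   ≡⟨ lookup∘tabulate (λ f → x (toℕ f)) (fromℕ< t<L) ⟩
    x (toℕ (fromℕ< t<L))             ≡⟨ cong x (toℕ-fromℕ< t<L) ⟩
    x t                              ∎
    where open ≡-Reasoning

  pap⇒prefixRecurrence : PreciselyAlmostPeriodic x → ∀ L → PrefixRecurrence x L
  pap⇒prefixRecurrence pap L
    with pap (prefix L) (0 , λ j → sym (lookup∘tabulate (λ f → x (toℕ f)) j))
  ... | a , d , d≥1 , occ = a , d , d≥1 , λ j → occursAt-prefix (occ j)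

equal-residues⇒∣ : ∀ {T} .{{_ : NonZero T}} a c → a mod T ≡ (a + c) mod T → T ∣ c
equal-residues⇒∣ {T} a c same = ∣m+n∣m⇒∣n (divides q₂ q₁T+c≡q₂T) (n∣m*n q₁)
  where
  open DivMod (a divMod T) renaming (quotient to q₁; property to a≡)
  open DivMod ((a + c) divMod T) renaming (quotient to q₂; property to a+c≡)
  r : ℕ
  r = toℕ (a mod T)
  q₁T+c≡q₂T : q₁ * T + c ≡ q₂ * T
  q₁T+c≡q₂T = +-cancelˡ-≡ r _ _ (begin
    r + (q₁ * T + c)         ≡⟨ sym (+-assoc r (q₁ * T) c) ⟩
    r + q₁ * T + c           ≡⟨ cong (_+ c) (sym a≡) ⟩
    a + c                    ≡⟨ a+c≡ ⟩
    toℕ ((a + c) mod T) + q₂ * T ≡⟨ cong (λ s → toℕ s + q₂ * T) (sym same) ⟩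
    r + q₂ * T               ∎)
    where open ≡-Reasoning

module Chain {A : Set} (x : Seq A) (recurrence : ∀ L → PrefixRecurrence x L) (N : ℕ) where

  len : ℕ → ℕ
  start : ℕ → ℕ

  len zero    = N
  len (suc k) = start k + len k

  start k = proj₁ (recurrence (len k))

  len≥N : ∀ k → N ≤ len k
  len≥N zero    = ≤-refl
  len≥N (suc k) = ≤-trans (len≥N k) (m≤n+m (len k) (start k))

  seg : ℕ → ℕ → ℕ
  seg i zero    = 0
  seg i (suc n) = seg (suc i) n + start i

  seg-split : ∀ i m n → seg i (m + n) ≡ seg i m + seg (m + i) n
  seg-split i zero    n = refl
  seg-split i (suc m) n = begin
    seg (suc i) (m + n) + start i                           ≡⟨ cong (_+ start i) (seg-split (suc i) m n) ⟩
    seg (suc i) m + seg (m + suc i) n + start i             ≡⟨ xy∙z≈xz∙y (seg (suc i) m) _ (start i) ⟩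
    seg (suc i) m + start i + seg (m + suc i) n             ≡⟨ cong (λ k → seg i (suc m) + seg k n) (+-suc m i) ⟩
    seg (suc i) m + start i + seg (suc (m + i)) n           ∎
    where open ≡-Reasoning

  startOccurrence : ∀ k → PrefixAt x (len k) (start k)
  startOccurrence k with recurrence (len k)
  ... | a , _ , _ , prog = subst (PrefixAt x (len k)) (+-identityʳ a) (prog 0)

  chainRecurrence : ∀ i n → Σ ℕ λ d → d ≥ 1 × PrefixProgression x (len i) (seg i (suc n)) d
  chainRecurrence i zero with recurrence (len i)
  ... | _ , d , d≥1 , prog = d , d≥1 , prog
  chainRecurrence i (suc n) with chainRecurrence (suc i) n
  ... | d , d≥1 , prog = d , d≥1 , progression-shift prog (startOccurrence i) ≤-refl

  -- Pigeonhole on the partial sums seg 0 k mod T, k = 0, …, T: some block sum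
  -- is divisible by T.
  divisibleBlock : ∀ T .{{_ : NonZero T}} → Σ ℕ λ i → Σ ℕ λ n → T ∣ seg i (suc n)
  divisibleBlock T with pigeonhole (n<1+n T) (λ k → seg 0 (toℕ k) mod T)
  ... | i , i' , i<i' , same =
    toℕ i , n , equal-residues⇒∣ (seg 0 (toℕ i)) (seg (toℕ i) (suc n)) (trans same sameSums)
    where
    n : ℕ
    n = toℕ i' ∸ suc (toℕ i)
    i+1+n≡i' : toℕ i + suc n ≡ toℕ i'
    i+1+n≡i' = trans (+-suc (toℕ i) n) (m+[n∸m]≡n i<i')
    sameSums : seg 0 (toℕ i') mod T ≡ (seg 0 (toℕ i) + seg (toℕ i) (suc n)) mod T
    sameSums = cong (_mod T) (begin
      seg 0 (toℕ i')                            ≡⟨ cong (seg 0) (sym i+1+n≡i') ⟩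
      seg 0 (toℕ i + suc n)                     ≡⟨ seg-split 0 (toℕ i) (suc n) ⟩
      seg 0 (toℕ i) + seg (toℕ i + 0) (suc n)   ≡⟨ cong (λ k → seg 0 (toℕ i) + seg k (suc n)) (+-identityʳ (toℕ i)) ⟩
      seg 0 (toℕ i) + seg (toℕ i) (suc n)       ∎)
      where open ≡-Reasoning

  alignedRecurrence : ∀ T .{{_ : NonZero T}} → Σ ℕ λ a → Σ ℕ λ d →
                      d ≥ 1 × T ∣ a × T ∣ d × PrefixProgression x N a d
  alignedRecurrence T with divisibleBlock T
  ... | i , n , T∣a with chainRecurrence i n
  ... | d , d≥1 , prog =
    seg i (suc n) , T * d , *-mono-≤ (>-nonZero⁻¹ T) d≥1 , T∣a , m∣m*n d ,
    progression-multiple T (progression-restrict (len≥N i) prog)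

module _ {B : Set} {y : Seq B} {T : ℕ} (period : ∀ i → y i ≡ y (i + T)) where

  shift-by-multiple : ∀ k z → y (k * T + z) ≡ y z
  shift-by-multiple zero    z = refl
  shift-by-multiple (suc k) z = begin
    y (T + k * T + z)   ≡⟨ cong y (xy∙z≈yz∙x T (k * T) z) ⟩
    y (k * T + z + T)   ≡⟨ sym (period (k * T + z)) ⟩
    y (k * T + z)       ≡⟨ shift-by-multiple k z ⟩
    y z                 ∎
    where open ≡-Reasoning

  aligned-prefixAt-product : ∀ {A} {x : Seq A} {L q} → PrefixAt x L q → T ∣ q →
                             PrefixAt (x ⊗ y) L q
  aligned-prefixAt-product recurs (divides k refl) t t<L =
    cong₂ _,_ (recurs t t<L) (shift-by-multiple k t)

  product-recurrence : ∀ {A} {x : Seq A} {m p a d} {w : Vec (A × B) m} → T ∣ a → T ∣ d →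
                       PrefixProgression x (p + m) a d → OccursAt (x ⊗ y) p w →
                       ∀ j → OccursAt (x ⊗ y) (a + p + j * d) w
  product-recurrence {x = x} {m} {p} {a} {d} {w} T∣a T∣d prog occ j =
    subst (λ q → OccursAt (x ⊗ y) q w) (sym (xy∙z≈xz∙y a p (j * d)))
      (occursAt-transfer {x = x ⊗ y} {w = w} recurs occ)
    where
    recurs : PrefixAt (x ⊗ y) (p + m) (a + j * d)
    recurs = aligned-prefixAt-product {x = x} (prog j) (∣m∣n⇒∣m+n T∣a (∣n⇒∣m*n j T∣d))

theorem17 : (k l : ℕ) (x : Seq (Fin k)) (y : Seq (Fin l)) →
    PreciselyAlmostPeriodic x → Periodic y → PreciselyAlmostPeriodic (x ⊗ y)
theorem17 k l x y pap (T@(suc _) , _ , period) {m} w (p , occ) =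
  let open Chain x (pap⇒prefixRecurrence pap) (p + m)
      (a , d , d≥1 , T∣a , T∣d , prog) = alignedRecurrence T
  in  a + p , d , d≥1 , product-recurrence period {w = w} T∣a T∣d prog occ
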